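{- Let $(\Gamma,\chi)$ be a model of $T_{pdg*}$ and let $G$ be a $\chi$-function. Then the function $x\mapsto\chi(G(x))$ on $\chi(\Gamma^{<0})$ is given piecewise by $\chi$-functions: there are $a_1,\dots,a_n\in\chi(\Gamma^{<0})\cup\{0\}$ with $c=a_1<\dots<a_n=0$ such that for each $i<n$ the restriction of $\chi(G(x))$ to $\{x\in\chi(\Gamma^{<0}):a_i\le x<a_{i+1}\}$ coincides there with a $\chi$-function.
   Context: For an ordered abelian group $\Gamma$, $\Gamma^{<0}=\{x\in\Gamma:x<0\}$, and $a,b$ are archimedean equivalent if $|a|\le n|b|$ and $|b|\le n|a|$ for some $n\ge1$. A precontraction group is a totally ordered abelian group $\Gamma$ with a map $\chi:\Gamma\to\Gamma$ such that for all $a,b$: (1) $\chi(a)=0\iff a=0$; (2) $a\le b\Rightarrow\chi(a)\le\chi(b)$; (3) $\chi(-a)=-\chi(a)$; (4) archimedean equivalent $a,b$ of the same sign have $\chi(a)=\chi(b)$. Centripetal: $|\chi(a)|<|a|$ for $a\neq0$. $T_{pdg}$ is the theory in $L_{pdg}=\{+,-,0,<,\chi,c\}$ of nontrivial centripetal precontraction groups with: (i) $\chi(\Gamma^{<0})$ has least element $c$; (ii) $\chi$ restricts to a bijection $\chi(\Gamma^{<0})\to\chi(\Gamma^{<0})^{>c}:=\{x\in\chi(\Gamma^{<0}):x>c\}$; (iii) for $a<b$ in $\chi(\Gamma^{<0})$, $a<\chi(a)\le b$; (iv) $\Gamma$ divisible. $L_{pdg*}=L_{pdg}\cup\{\infty,\chi^{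 -1},\delta_1,\delta_2,\dots\}$; models of $T_{pdg}$ are viewed as $L_{pdg*}$-structures on $\Gamma_\infty=\Gamma\cup\{\infty\}$ with $x<\infty$ for $x\in\Gamma$, $x+\infty=\infty+x=-\infty=\chi(\infty)=\infty$, $\delta_n$ division by $n$, $\chi^{ -1}$ the inverse of $\chi:\chi(\Gamma^{<0})\to\chi(\Gamma^{<0})^{>c}$ on $\chi(\Gamma^{<0})^{>c}$, $\chi^{ -1}(0)=0$, $\chi^{ -1}(c)=\infty$, $\chi^{ -1}(a)=\infty$ otherwise; $T_{pdg*}$ is the theory of these expansions. For $x\in\chi(\Gamma^{<0})$ and $k\in\mathbb{Z}$: $\chi^0(x)=x$, $\chi^k$ is the $k$-fold iterate of $\chi$ for $k>0$, and $\chi^k=(\chi^{ -1})^{ -k}$ for $k<0$. A $\chi$-function is a function $G:\chi(\Gamma^{<0})\to\Gamma_\infty$ that is constant or of the form $G(x)=\sum_{i=1}^n q_i\chi^{k_i}(x)-\alpha$ with $n>0$, integers $k_1<\dots<k_n$, $q_i\in\mathbb{Q}\setminus\{0\}$ and $\alpha\in\Gamma$ (with $\infty$ absorbing in sums). -}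

module Defs where

open import Level using (Level)
open import Data.Nat using (ℕ; zero; suc; _∸_)
open import Data.Integer using (ℤ; +_; -[1+_]) renaming (_<_ to _<ℤ_)
open import Data.Unit using (⊤)
open import Data.Rational using (ℚ; ↥_; ↧ₙ_; 0ℚ)
open import Data.List using (List; []; _∷_)
open import Data.Product using (Σ; _×_; _,_; ∃)
open import Data.Sum using (_⊎_)
open import Data.Empty using (⊥)
open import Relation.Nullary using (¬_)
open import Relation.Binary.PropositionalEquality using (_≡_; _≢_)

data Ext (A : Set) : Set where
  fin : A → Ext A
  ∞   : Ext A

module Gen {Γ : Set} (_+_ : Γ → Γ → Γ) (-_ : Γ → Γ) (0# : Γ)
           (_<_ : Γ → Γ → Set) (χ : Γ → Γ) where
  infix 4 _≤_

  _≤_ : Γ → Γ → Set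
  a ≤ b = a < b ⊎ a ≡ b

  natmul : ℕ → Γ → Γ
  natmul zero    a = 0#
  natmul (suc n) a = a + natmul n a

  Abs : Γ → Γ → Set
  Abs a r = (0# ≤ a × r ≡ a) ⊎ (a < 0# × r ≡ - a)

  ArchEq : Γ → Γ → Set
  ArchEq a b = ∀ ra rb → Abs a ra → Abs b rb →
    Σ ℕ λ n → ra ≤ natmul (suc n) rb × rb ≤ natmul (suc n) ra

  SameSign : Γ → Γ → Set
  SameSign a b = (a < 0# × b < 0#) ⊎ (0# < a × 0# < b) ⊎ (a ≡ 0# × b ≡ 0#)

  InS : Γ → Set
  InS x = Σ Γ λ a → a < 0# × χ a ≡ x

-- A model of T_pdg, expanded to the L_pdg* structure (χ⁻¹ and the δ_n
-- are part of the structure, characterised by their defining axioms).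
record PDG : Set₁ where
  infixl 6 _+_
  infix 8 -_
  infix 4 _<_
  field
    Γ   : Set
    _+_ : Γ → Γ → Γ
    -_  : Γ → Γ
    0#  : Γ
    _<_ : Γ → Γ → Set
    c   : Γ
    χ   : Γ → Γ
    χ⁻¹ : Ext Γ → Ext Γ
    δ   : ℕ → Γ → Γ     -- δ n = division by (n+1), i.e. δ_{n+1} of the paper

  open Gen _+_ -_ 0# _<_ χ public

  field
    +-assoc   : ∀ a b d → (a + b) + d ≡ a + (b + d)
    +-comm    : ∀ a b → a + b ≡ b + a
    +-identityˡ : ∀ a → 0# + a ≡ a
    +-inverseˡ  : ∀ a → (- a) + a ≡ 0#
    <-irrefl  : ∀ a → ¬ (a < a)
    <-trans   : ∀ {a b d} → a < b → b < d → a < d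
    <-tri     : ∀ a b → a < b ⊎ a ≡ b ⊎ b < a
    <-+       : ∀ {a b} d → a < b → a + d < b + d
    nontrivial : ∃ λ a → a ≢ 0#
    χ-zero  : ∀ a → (χ a ≡ 0# → a ≡ 0#) × (a ≡ 0# → χ a ≡ 0#)
    χ-mono  : ∀ {a b} → a ≤ b → χ a ≤ χ b
    χ-odd   : ∀ a → χ (- a) ≡ - χ a
    χ-arch  : ∀ a b → ArchEq a b → SameSign a b → χ a ≡ χ b
    χ-centripetal : ∀ a ra rχ → a ≢ 0# → Abs a ra → Abs (χ a) rχ → rχ < ra
    c-in    : InS c
    c-least : ∀ x → InS x → c ≤ x
    χ-S-into : ∀ x → InS x → InS (χ x) × c < χ x
    χ-S-inj  : ∀ x y → InS x → InS y → χ x ≡ χ y → x ≡ y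
    χ-S-onto : ∀ y → InS y → c < y → Σ Γ λ x → InS x × χ x ≡ y
    χ-S-between : ∀ a b → InS a → InS b → a < b → a < χ a × χ a ≤ b
    δ-spec : ∀ n a → natmul (suc n) (δ n a) ≡ a
    χ⁻¹-zero : χ⁻¹ (fin 0#) ≡ fin 0#
    χ⁻¹-c    : χ⁻¹ (fin c) ≡ ∞
    χ⁻¹-S    : ∀ x → InS x → χ⁻¹ (fin (χ x)) ≡ fin x
    χ⁻¹-else : ∀ a → a ≢ 0# → a ≢ c → ¬ (InS a × c < a) → χ⁻¹ (fin a) ≡ ∞
    χ⁻¹-∞    : χ⁻¹ ∞ ≡ ∞

module _ (M : PDG) where
  open PDG M

  _+∞_ : Ext Γ → Ext Γ → Ext Γ
  fin a +∞ fin b = fin (a + b)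
  fin a +∞ ∞     = ∞
  ∞     +∞ _     = ∞

  χ∞ : Ext Γ → Ext Γ
  χ∞ (fin a) = fin (χ a)
  χ∞ ∞       = ∞

  iter : ℕ → (Ext Γ → Ext Γ) → Ext Γ → Ext Γ
  iter zero    f x = x
  iter (suc n) f x = f (iter n f x)

  χ^ : ℤ → Ext Γ → Ext Γ
  χ^ (+ n)     = iter n χ∞
  χ^ -[1+ n ]  = iter (suc n) χ⁻¹

  zmul : ℤ → Γ → Γ
  zmul (+ n)    a = natmul n a
  zmul -[1+ n ] a = - natmul (suc n) a

  qmul : ℚ → Ext Γ → Ext Γ
  qmul q (fin a) = fin (zmul (↥ q) (δ ((↧ₙ q) ∸ 1) a))
  qmul q ∞       = ∞

  StrictlyIncr : List (ℚ × ℤ) → Set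
  StrictlyIncr []                 = ⊤
  StrictlyIncr (_ ∷ [])           = ⊤
  StrictlyIncr ((_ , k) ∷ (q' , k') ∷ ts) =
    k <ℤ k' × StrictlyIncr ((q' , k') ∷ ts)

  NonzeroCoeffs : List (ℚ × ℤ) → Set
  NonzeroCoeffs []             = ⊤
  NonzeroCoeffs ((q , _) ∷ ts) = q ≢ 0ℚ × NonzeroCoeffs ts

  evalTerms : List (ℚ × ℤ) → Γ → Ext Γ
  evalTerms []             x = fin 0#
  evalTerms ((q , k) ∷ ts) x = qmul q (χ^ k (fin x)) +∞ evalTerms ts x

  -- G is a χ-function (only its values on χ(Γ^{<0}) matter)
  IsChiFunction : (Γ → Ext Γ) → Set
  IsChiFunction G =
    (Σ (Ext Γ) λ v → ∀ x → InS x → G x ≡ v)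
    ⊎ (Σ (List (ℚ × ℤ)) λ ts → Σ Γ λ α →
         ts ≢ [] × StrictlyIncr ts × NonzeroCoeffs ts ×
         (∀ x → InS x → G x ≡ (evalTerms ts x +∞ fin (- α))))

module Submission where

-- Write the χ-function as G(x) = q·χ^k(x) + r(x) - α with q·χ^k(x) the term of
-- least exponent, and put t = χ^k(x).  The later terms are rational multiples of
-- iterates χ^j(t), j ≥ 1, which are infinitesimal compared with t because
-- χ(t) < χ(χ^j t); so r(x) ≪ t.  Hence χ(G(x)) is sign(q)·χ^{k+1}(x) where α ≪ t,
-- and the constant χ(-α) where t ≪ -|α|.  Comparing χ(t) with χ(-|α|) = χ(g) and
-- using that x ↦ χ^k(x) is strictly increasing, the two regimes are separated
-- by the point z with χ^k(z) = g, and [z, χ z) ∩ χ(Γ^{<0}) = {z}.  For k < 0 an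
-- initial segment, where χ^k(x) = ∞ and so G = ∞, comes first.

open import Defs
open import Data.Nat using (ℕ; suc) renaming (_<_ to _<ℕ_; _≤_ to _≤ℕ_)
open import Data.Product using (Σ; _×_)
open import Data.Sum using (_⊎_)
open import Relation.Binary.PropositionalEquality using (_≡_)

open import Level using (0ℓ)
open import Algebra.Bundles using (AbelianGroup)
import Algebra.Properties.AbelianGroup as AbelianGroupProperties
import Algebra.Properties.CommutativeMonoid.Mult as MultProperties
open import Data.Nat using (zero; z≤n; s≤s; _∸_) renaming (_+_ to _+ℕ_; _*_ to _*ℕ_)
import Data.Nat.Properties as ℕ
open import Data.Integer using (ℤ; -[1+_]; -<-; -<+; +<+)
  renaming (+_ to pos; suc to sucℤ; _<_ to _<ℤ_)
open import Function using (_∘_)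
open import Data.Rational using (ℚ; ↥_; ↧ₙ_; 0ℚ; 1ℚ) renaming (-_ to -ℚ_)
open import Data.Rational.Properties using (↥p≡0⇒p≡0)
open import Data.List using (List; []; _∷_)
open import Data.Unit using (tt)
open import Data.Product using (_,_; proj₁; proj₂)
open import Data.Sum using (inj₁; inj₂)
open import Data.Empty using (⊥-elim)
open import Relation.Nullary using (¬_)
open import Relation.Binary.PropositionalEquality
  using (refl; sym; trans; cong; cong₂; subst; subst₂; _≢_; isEquivalence; module ≡-Reasoning)

module Partitions {A : Set} (_<_ : A → A → Set)
                  (Endpoint : A → Set) (Good : A → A → Set) where

  infixr 5 _++_

  data Partition : A → A → Set where
    stop  : ∀ {r} → Partition r r
    piece : ∀ {l m r} → l < m → Endpoint m → Good l m → Partition m r → Partition l r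

  _++_ : ∀ {l m r} → Partition l m → Partition m r → Partition l r
  stop             ++ Q = Q
  piece l<m em g P ++ Q = piece l<m em g (P ++ Q)

  single : ∀ {l r} → l < r → Endpoint r → Good l r → Partition l r
  single l<r er g = piece l<r er g stop

  size : ∀ {l r} → Partition l r → ℕ
  size stop            = 0
  size (piece _ _ _ P) = suc (size P)

  -- the i-th breakpoint; point P 0 = l and point P (size P) = r
  point : ∀ {l r} → Partition l r → ℕ → A
  point {l} P               zero    = l
  point {l} stop            (suc i) = l
  point     (piece _ _ _ P) (suc i) = point P i

  point-last : ∀ {l r} (P : Partition l r) → point P (size P) ≡ r
  point-last stop            = refl
  point-last (piece _ _ _ P) = point-last P

  point-endpoint : ∀ {l r} → Endpoint l → (P : Partition l r) →
                   ∀ i → i ≤ℕ size P → Endpoint (point P i)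
  point-endpoint el P                zero    _         = el
  point-endpoint el (piece _ em _ P) (suc i) (s≤s i≤n) = point-endpoint em P i i≤n

  point-increasing : ∀ {l r} (P : Partition l r) →
                     ∀ i → i <ℕ size P → point P i < point P (suc i)
  point-increasing (piece l<m _ _ P) zero    _         = l<m
  point-increasing (piece _ _ _ P)   (suc i) (s≤s i<n) = point-increasing P i i<n

  point-good : ∀ {l r} (P : Partition l r) →
               ∀ i → i <ℕ size P → Good (point P i) (point P (suc i))
  point-good (piece _ _ g P) zero    _         = g
  point-good (piece _ _ _ P) (suc i) (s≤s i<n) = point-good P i i<n

  -- the breakpoint-sequence form used in the statement of the theorem
  Sequence : A → A → Set
  Sequence l r = Σ ℕ λ n → Σ (ℕ → A) λ a →
    a 0 ≡ l × a n ≡ r ×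
    (∀ i → i ≤ℕ n → Endpoint (a i)) ×
    (∀ i → i <ℕ n → a i < a (suc i)) ×
    (∀ i → i <ℕ n → Good (a i) (a (suc i)))

  toSequence : ∀ {l r} → Endpoint l → Partition l r → Sequence l r
  toSequence el P = size P , point P , refl , point-last P ,
                    point-endpoint el P , point-increasing P , point-good P

module OrderedGroup (M : PDG) where
  open PDG M

  -- the group reduct of M as a library abelian group, to reuse its derived laws
  abelianGroup : AbelianGroup 0ℓ 0ℓ
  abelianGroup = record
    { Carrier = Γ ; _≈_ = _≡_ ; _∙_ = _+_ ; ε = 0# ; _⁻¹ = -_
    ; isAbelianGroup = record
      { isGroup = record
        { isMonoid = record
          { isSemigroup = record
            { isMagma = record { isEquivalence = isEquivalence ; ∙-cong = cong₂ _+_ }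
            ; assoc = +-assoc }
          ; identity = +-identityˡ , λ a → trans (+-comm a 0#) (+-identityˡ a) }
        ; inverse = +-inverseˡ , λ a → trans (+-comm a (- a)) (+-inverseˡ a)
        ; ⁻¹-cong = cong -_ }
      ; comm = +-comm } }

  open AbelianGroup abelianGroup public using (identityʳ; inverseʳ)
  open AbelianGroupProperties abelianGroup public using (⁻¹-involutive; ε⁻¹≈ε)
  open AbelianGroupProperties abelianGroup using (⁻¹-∙-comm)
  open MultProperties (AbelianGroup.commutativeMonoid abelianGroup)
    using (×-homo-+; ×-assocˡ; ×-distrib-+) renaming (_×_ to _×ₘ_)

  neg-+ : ∀ a b → - (a + b) ≡ - a + - b
  neg-+ a b = sym (⁻¹-∙-comm a b)

  natmul≗× : ∀ n a → natmul n a ≡ n ×ₘ a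
  natmul≗× zero    a = refl
  natmul≗× (suc n) a = cong (a +_) (natmul≗× n a)

  natmul-1 : ∀ a → natmul 1 a ≡ a
  natmul-1 = identityʳ

  natmul-+ : ∀ m n a → natmul (m +ℕ n) a ≡ natmul m a + natmul n a
  natmul-+ m n a rewrite natmul≗× (m +ℕ n) a | natmul≗× m a | natmul≗× n a = ×-homo-+ a m n

  natmul-* : ∀ m n a → natmul (m *ℕ n) a ≡ natmul m (natmul n a)
  natmul-* m n a rewrite natmul≗× n a | natmul≗× m (n ×ₘ a) | natmul≗× (m *ℕ n) a =
    sym (×-assocˡ a m n)

  natmul-comm : ∀ m n a → natmul m (natmul n a) ≡ natmul n (natmul m a)
  natmul-comm m n a =
    trans (sym (natmul-* m n a)) (trans (cong (λ j → natmul j a) (ℕ.*-comm m n)) (natmul-* n m a))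

  natmul-distrib : ∀ m a b → natmul m (a + b) ≡ natmul m a + natmul m b
  natmul-distrib m a b rewrite natmul≗× m (a + b) | natmul≗× m a | natmul≗× m b = ×-distrib-+ a b m

  natmul-0 : ∀ m → natmul m 0# ≡ 0#
  natmul-0 zero    = refl
  natmul-0 (suc m) = trans (+-identityˡ _) (natmul-0 m)

  natmul-neg : ∀ m a → natmul m (- a) ≡ - natmul m a
  natmul-neg zero    a = sym ε⁻¹≈ε
  natmul-neg (suc m) a = trans (cong (- a +_) (natmul-neg m a)) (sym (neg-+ a _))

  <-≤-trans : ∀ {a b d} → a < b → b ≤ d → a < d
  <-≤-trans a<b (inj₁ b<d)  = <-trans a<b b<d
  <-≤-trans a<b (inj₂ refl) = a<b

  ≤-<-trans : ∀ {a b d} → a ≤ b → b < d → a < d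
  ≤-<-trans (inj₁ a<b)  b<d = <-trans a<b b<d
  ≤-<-trans (inj₂ refl) b<d = b<d

  ≤-trans : ∀ {a b d} → a ≤ b → b ≤ d → a ≤ d
  ≤-trans (inj₁ a<b)  b≤d = inj₁ (<-≤-trans a<b b≤d)
  ≤-trans (inj₂ refl) b≤d = b≤d

  <⇒≱ : ∀ {a b} → a < b → ¬ (b ≤ a)
  <⇒≱ a<b b≤a = <-irrefl _ (<-≤-trans a<b b≤a)

  <⊎≥ : ∀ a b → a < b ⊎ b ≤ a
  <⊎≥ a b with <-tri a b
  ... | inj₁ a<b         = inj₁ a<b
  ... | inj₂ (inj₁ refl) = inj₂ (inj₂ refl)
  ... | inj₂ (inj₂ b<a)  = inj₂ (inj₁ b<a)

  +-monoʳ-< : ∀ {a b} d → a < b → d + a < d + b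
  +-monoʳ-< {a} {b} d a<b = subst₂ _<_ (+-comm a d) (+-comm b d) (<-+ d a<b)

  +-monoˡ-≤ : ∀ {a b} d → a ≤ b → a + d ≤ b + d
  +-monoˡ-≤ d (inj₁ a<b)  = inj₁ (<-+ d a<b)
  +-monoˡ-≤ d (inj₂ refl) = inj₂ refl

  +-monoʳ-≤ : ∀ {a b} d → a ≤ b → d + a ≤ d + b
  +-monoʳ-≤ d (inj₁ a<b)  = inj₁ (+-monoʳ-< d a<b)
  +-monoʳ-≤ d (inj₂ refl) = inj₂ refl

  +-mono-< : ∀ {a b d e} → a < b → d < e → a + d < b + e
  +-mono-< a<b d<e = <-trans (<-+ _ a<b) (+-monoʳ-< _ d<e)

  +-mono-≤-< : ∀ {a b d e} → a ≤ b → d < e → a + d < b + e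
  +-mono-≤-< a≤b d<e = ≤-<-trans (+-monoˡ-≤ _ a≤b) (+-monoʳ-< _ d<e)

  +-mono-<-≤ : ∀ {a b d e} → a < b → d ≤ e → a + d < b + e
  +-mono-<-≤ a<b d≤e = <-≤-trans (<-+ _ a<b) (+-monoʳ-≤ _ d≤e)

  +-mono-≤ : ∀ {a b d e} → a ≤ b → d ≤ e → a + d ≤ b + e
  +-mono-≤ a≤b d≤e = ≤-trans (+-monoˡ-≤ _ a≤b) (+-monoʳ-≤ _ d≤e)

  neg-antimono-< : ∀ {a b} → a < b → - b < - a
  neg-antimono-< {a} {b} a<b = subst₂ _<_ a-cancels b-cancels (<-+ (- a + - b) a<b)
    where
    a-cancels : a + (- a + - b) ≡ - b
    a-cancels = trans (sym (+-assoc a (- a) (- b)))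
                (trans (cong (_+ - b) (inverseʳ a)) (+-identityˡ (- b)))
    b-cancels : b + (- a + - b) ≡ - a
    b-cancels = trans (cong (b +_) (+-comm (- a) (- b)))
                (trans (sym (+-assoc b (- b) (- a)))
                (trans (cong (_+ - a) (inverseʳ b)) (+-identityˡ (- a))))

  neg-antimono-≤ : ∀ {a b} → a ≤ b → - b ≤ - a
  neg-antimono-≤ (inj₁ a<b)  = inj₁ (neg-antimono-< a<b)
  neg-antimono-≤ (inj₂ refl) = inj₂ refl

  neg-reflects-< : ∀ {a b} → - b < - a → a < b
  neg-reflects-< {a} {b} -b<-a =
    subst₂ _<_ (⁻¹-involutive a) (⁻¹-involutive b) (neg-antimono-< -b<-a)

  neg-of-negative : ∀ {a} → a < 0# → 0# < - a
  neg-of-negative {a} a<0 = subst (_< - a) ε⁻¹≈ε (neg-antimono-< a<0)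

  neg-of-positive : ∀ {a} → 0# < a → - a < 0#
  neg-of-positive {a} 0<a = subst (- a <_) ε⁻¹≈ε (neg-antimono-< 0<a)

  abs-of-negative : ∀ {a r} → a < 0# → Abs a r → r ≡ - a
  abs-of-negative a<0 (inj₁ (0≤a , _)) = ⊥-elim (<⇒≱ a<0 0≤a)
  abs-of-negative a<0 (inj₂ (_ , r≡-a)) = r≡-a

  halve-< : ∀ {a b} → a + a < b + b → a < b
  halve-< {a} {b} 2a<2b with <⊎≥ a b
  ... | inj₁ a<b = a<b
  ... | inj₂ b≤a = ⊥-elim (<⇒≱ 2a<2b (+-mono-≤ b≤a b≤a))

  natmul-mono : ∀ m {a b} → a ≤ b → natmul m a ≤ natmul m b
  natmul-mono zero    a≤b = inj₂ refl
  natmul-mono (suc m) a≤b = +-mono-≤ a≤b (natmul-mono m a≤b)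

  natmul-nonneg : ∀ m {a} → 0# ≤ a → 0# ≤ natmul m a
  natmul-nonneg m {a} 0≤a = subst (_≤ natmul m a) (natmul-0 m) (natmul-mono m 0≤a)

  natmul-nonpos : ∀ m {a} → a ≤ 0# → natmul m a ≤ 0#
  natmul-nonpos m {a} a≤0 = subst (natmul m a ≤_) (natmul-0 m) (natmul-mono m a≤0)

  natmul-antitone : ∀ {a m n} → m ≤ℕ n → a ≤ 0# → natmul n a ≤ natmul m a
  natmul-antitone {a} {m} {n} m≤n a≤0 =
    subst (λ j → natmul j a ≤ natmul m a) (ℕ.m+[n∸m]≡n m≤n)
      (subst₂ _≤_ (sym (natmul-+ m (n ∸ m) a)) (identityʳ (natmul m a))
        (+-monoʳ-≤ (natmul m a) (natmul-nonpos (n ∸ m) a≤0)))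

  natmul-below-self : ∀ n {a} → a ≤ 0# → natmul (suc n) a ≤ a
  natmul-below-self n {a} a≤0 = subst (natmul (suc n) a ≤_) (natmul-1 a) (natmul-antitone {m = 1} {n = suc n} (s≤s z≤n) a≤0)

  negative-of-multiple : ∀ {a N} n → N < 0# → natmul (suc n) a ≤ N → a < 0#
  negative-of-multiple {a} n N<0 na≤N with <⊎≥ a 0#
  ... | inj₁ a<0 = a<0
  ... | inj₂ 0≤a = ⊥-elim (<⇒≱ (≤-<-trans na≤N N<0) (natmul-nonneg (suc n) 0≤a))

module Archimedean (M : PDG) where
  open PDG M
  open OrderedGroup M

  infix 4 _≪_ _≍_

  -- u ≪ N: u is infinitesimal compared with N, i.e. m·|u| < |N| for all m
  _≪_ : Γ → Γ → Set
  u ≪ N = ∀ m → N < natmul m u × N < natmul m (- u)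

  _≍_ : Γ → Γ → Set
  P ≍ N = (Σ ℕ λ n → natmul (suc n) P ≤ N) × (Σ ℕ λ n → natmul (suc n) N ≤ P)

  ≪-neg : ∀ {u N} → u ≪ N → - u ≪ N
  ≪-neg {u} u≪N m = proj₂ (u≪N m) , subst (λ v → _ < natmul m v) (sym (⁻¹-involutive u)) (proj₁ (u≪N m))

  ≪-zero : ∀ {N} → N < 0# → 0# ≪ N
  ≪-zero {N} N<0 m = subst (N <_) (sym (natmul-0 m)) N<0 ,
                     subst (N <_) (sym (trans (cong (natmul m) ε⁻¹≈ε) (natmul-0 m))) N<0

  ≪-+ : ∀ {u v N} → u ≪ N → v ≪ N → u + v ≪ N
  ≪-+ {u} {v} {N} u≪N v≪N m =
    bound u v u≪N v≪N , subst (λ w → N < natmul m w) (sym (neg-+ u v)) (bound (- u) (- v) (≪-neg u≪N) (≪-neg v≪N))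
    where
    -- 2N < 2m·u + 2m·v, then halve
    bound : ∀ u v → u ≪ N → v ≪ N → N < natmul m (u + v)
    bound u v u≪N v≪N = halve-< (subst (N + N <_) doubled (+-mono-< (proj₁ (u≪N (m +ℕ m))) (proj₁ (v≪N (m +ℕ m)))))
      where
      doubled : natmul (m +ℕ m) u + natmul (m +ℕ m) v ≡ natmul m (u + v) + natmul m (u + v)
      doubled = trans (sym (natmul-distrib (m +ℕ m) u v)) (natmul-+ m m (u + v))

  ≪-trans : ∀ {r t N} → r ≪ t → t ≪ N → r ≪ N
  ≪-trans {r} {t} {N} r≪t t≪N m = bound r (proj₁ (r≪t 1)) , bound (- r) (proj₂ (r≪t 1))
    where
    -- N < m·t ≤ m·s whenever t < s
    bound : ∀ s → t < natmul 1 s → N < natmul m s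
    bound s t<s = <-≤-trans (proj₁ (t≪N m)) (natmul-mono m (inj₁ (subst (t <_) (natmul-1 s) t<s)))

  ≪-natmul : ∀ {e N} k → e ≪ N → natmul k e ≪ N
  ≪-natmul {e} {N} k e≪N m =
    subst (N <_) (natmul-* m k e) (proj₁ (e≪N (m *ℕ k))) ,
    subst (N <_) (trans (natmul-* m k (- e)) (cong (natmul m) (natmul-neg k e))) (proj₂ (e≪N (m *ℕ k)))

  ≪-zmul : ∀ {e N} p → e ≪ N → zmul M p e ≪ N
  ≪-zmul (pos k)  e≪N = ≪-natmul k e≪N
  ≪-zmul -[1+ k ] e≪N = ≪-neg (≪-natmul (suc k) e≪N)

  divided-bound : ∀ {e w N} d → N < 0# → natmul (suc d) e ≡ w →
                  (∀ m → N < natmul m w) → ∀ m → N < natmul m e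
  divided-bound {e} {w} {N} d N<0 de≡w bound m with <⊎≥ e 0#
  ... | inj₁ e<0 = <-≤-trans (subst (N <_) md·e≡m·w (bound m)) (natmul-antitone (ℕ.m≤m*n m (suc d)) (inj₁ e<0))
    where
    md·e≡m·w : natmul m w ≡ natmul (m *ℕ suc d) e
    md·e≡m·w = trans (cong (natmul m) (sym de≡w)) (sym (natmul-* m (suc d) e))
  ... | inj₂ 0≤e = <-≤-trans N<0 (natmul-nonneg m 0≤e)

  ≪-divide : ∀ {e t N} d → natmul (suc d) e ≡ t → N < 0# → t ≪ N → e ≪ N
  ≪-divide {e} d de≡t N<0 t≪N m =
    divided-bound d N<0 de≡t (proj₁ ∘ t≪N) m ,
    divided-bound d N<0 (trans (natmul-neg (suc d) e) (cong -_ de≡t)) (proj₂ ∘ t≪N) m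

  ≍-refl : ∀ {N} → N ≍ N
  ≍-refl {N} = (0 , inj₂ (natmul-1 N)) , (0 , inj₂ (natmul-1 N))

  ≍-negative : ∀ {P N} → N < 0# → P ≍ N → P < 0#
  ≍-negative N<0 ((n , nP≤N) , _) = negative-of-multiple n N<0 nP≤N

  ≍-+ : ∀ {P r N} → N < 0# → P ≍ N → r ≪ N → P + r ≍ N
  ≍-+ {P} {r} {N} N<0 ((n₁ , n₁P≤N) , (n₂ , n₂N≤P)) r≪N = (n₁ +ℕ suc n₁ , upper) , (suc n₂ , lower)
    where
    k = suc n₁
    -- 2k·P ≤ 2N and 2k·r < -N, so 2k·(P + r) < N
    2kr<-N : natmul (k +ℕ k) r < - N
    2kr<-N = subst (_< - N) (trans (cong -_ (natmul-neg (k +ℕ k) r)) (⁻¹-involutive _))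
               (neg-antimono-< (proj₂ (r≪N (k +ℕ k))))
    2kP≤2N : natmul (k +ℕ k) P ≤ N + N
    2kP≤2N = subst (_≤ N + N) (sym (natmul-+ k k P)) (+-mono-≤ n₁P≤N n₁P≤N)
    2N-N≡N : (N + N) + - N ≡ N
    2N-N≡N = trans (+-assoc N N (- N)) (trans (cong (N +_) (inverseʳ N)) (identityʳ N))
    upper : natmul (suc (n₁ +ℕ suc n₁)) (P + r) ≤ N
    upper = inj₁ (subst₂ _<_ (sym (natmul-distrib (k +ℕ k) P r)) 2N-N≡N (+-mono-≤-< 2kP≤2N 2kr<-N))
    -- (n₂+2)·N = N + (n₂+1)·N < r + P
    lower : natmul (suc (suc n₂)) N ≤ P + r
    lower = subst (natmul (suc (suc n₂)) N ≤_) (+-comm r P)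
              (inj₁ (+-mono-<-≤ (subst (N <_) (natmul-1 r) (proj₁ (r≪N 1))) n₂N≤P))

  ≍-fraction : ∀ {t e} d k → t < 0# → natmul (suc d) e ≡ t → natmul (suc k) e ≍ t
  ≍-fraction {t} {e} d k t<0 de≡t = (d , upper) , (k , natmul-mono (suc k) t≤e)
    where
    e<0 : e < 0#
    e<0 = negative-of-multiple d t<0 (inj₂ de≡t)
    upper : natmul (suc d) (natmul (suc k) e) ≤ t
    upper = subst (_≤ t) (trans (cong (natmul (suc k)) (sym de≡t)) (natmul-comm (suc k) (suc d) e))
              (natmul-below-self k (inj₁ t<0))
    t≤e : t ≤ e
    t≤e = subst (_≤ e) de≡t (natmul-below-self d (inj₁ e<0))

  -- χ is constant on archimedean classes (axiom χ-arch in multiple form)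
  χ-≍ : ∀ {P N} → N < 0# → P ≍ N → χ P ≡ χ N
  χ-≍ {P} {N} N<0 P≍N@((n₁ , n₁P≤N) , (n₂ , n₂N≤P)) = χ-arch P N archEq (inj₁ (P<0 , N<0))
    where
    P<0 = ≍-negative N<0 P≍N
    n = n₁ +ℕ n₂
    -- one multiplier serves both bounds, as multiples of negatives decrease
    nP≤N : natmul (suc n) P ≤ N
    nP≤N = ≤-trans (natmul-antitone (s≤s (ℕ.m≤m+n n₁ n₂)) (inj₁ P<0)) n₁P≤N
    nN≤P : natmul (suc n) N ≤ P
    nN≤P = ≤-trans (natmul-antitone (s≤s (ℕ.m≤n+m n₂ n₁)) (inj₁ N<0)) n₂N≤P
    archEq : ArchEq P N
    archEq rP rN absP absN rewrite abs-of-negative P<0 absP | abs-of-negative N<0 absN =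
      n , subst (- P ≤_) (sym (natmul-neg (suc n) N)) (neg-antimono-≤ nN≤P)
        , subst (- N ≤_) (sym (natmul-neg (suc n) P)) (neg-antimono-≤ nP≤N)

  χ<χ⇒≪ : ∀ {a b} → a < 0# → b < 0# → χ a < χ b → b ≪ a
  χ<χ⇒≪ {a} {b} a<0 b<0 χa<χb m =
    a<m·b m , <-≤-trans a<0 (natmul-nonneg m (inj₁ (neg-of-negative b<0)))
    where
    a≤b : a ≤ b
    a≤b with <⊎≥ b a
    ... | inj₁ b<a = ⊥-elim (<⇒≱ χa<χb (χ-mono (inj₁ b<a)))
    ... | inj₂ a≤b = a≤b
    -- otherwise b and a would be archimedean equivalent, so χ a = χ b
    a<m·b : ∀ m → a < natmul m b
    a<m·b zero = a<0
    a<m·b (suc n) with <⊎≥ a (natmul (suc n) b)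
    ... | inj₁ a<nb = a<nb
    ... | inj₂ nb≤a = ⊥-elim (<-irrefl _ (subst (χ a <_) (χ-≍ a<0 b≍a) χa<χb))
      where
      b≍a : b ≍ a
      b≍a = (n , nb≤a) , (n , ≤-trans (natmul-below-self n (inj₁ a<0)) a≤b)

  χ-perturb : ∀ {P u N} → N < 0# → P ≍ N → u ≪ N → χ (P + u) ≡ χ N
  χ-perturb N<0 P≍N u≪N = χ-≍ N<0 (≍-+ N<0 P≍N u≪N)

  χ-perturb-neg : ∀ {P u N} → N < 0# → P ≍ N → u ≪ N → χ (- P + u) ≡ - χ N
  χ-perturb-neg {P} {u} {N} N<0 P≍N u≪N = begin
    χ (- P + u)         ≡⟨ cong χ (sym negated) ⟩
    χ (- (P + - u))     ≡⟨ χ-odd (P + - u) ⟩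
    - χ (P + - u)       ≡⟨ cong -_ (χ-perturb N<0 P≍N (≪-neg u≪N)) ⟩
    - χ N               ∎
    where
    open ≡-Reasoning
    negated : - (P + - u) ≡ - P + u
    negated = trans (neg-+ P (- u)) (cong (- P +_) (⁻¹-involutive u))

  χ-absorbs : ∀ {s β A} → A < 0# → (β ≡ A ⊎ β ≡ - A) → s ≪ A → χ (s + β) ≡ χ β
  χ-absorbs {s} A<0 (inj₁ refl) s≪A = trans (cong χ (+-comm s _)) (χ-perturb A<0 ≍-refl s≪A)
  χ-absorbs {s} {_} {A} A<0 (inj₂ refl) s≪A =
    trans (cong χ (+-comm s _)) (trans (χ-perturb-neg A<0 ≍-refl s≪A) (sym (χ-odd A)))

infixl 6 _+ᴺ_
_+ᴺ_ : ℤ → ℕ → ℤ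
k +ᴺ zero  = k
k +ᴺ suc j = sucℤ (k +ᴺ j)

+ᴺ-pos : ∀ m j → pos m +ᴺ j ≡ pos (m +ℕ j)
+ᴺ-pos m zero    = cong pos (sym (ℕ.+-identityʳ m))
+ᴺ-pos m (suc j) = trans (cong sucℤ (+ᴺ-pos m j)) (cong pos (sym (ℕ.+-suc m j)))

+ᴺ-neg : ∀ j d → -[1+ j +ℕ d ] +ᴺ j ≡ -[1+ d ]
+ᴺ-neg zero    d = refl
+ᴺ-neg (suc j) d = trans (cong (λ n → sucℤ (-[1+ n ] +ᴺ j)) (sym (ℕ.+-suc j d))) (cong sucℤ (+ᴺ-neg j (suc d)))

+ᴺ-assoc : ∀ k a b → k +ᴺ a +ᴺ b ≡ k +ᴺ (a +ℕ b)
+ᴺ-assoc k a zero    = cong (k +ᴺ_) (sym (ℕ.+-identityʳ a))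
+ᴺ-assoc k a (suc b) = trans (cong sucℤ (+ᴺ-assoc k a b)) (cong (k +ᴺ_) (sym (ℕ.+-suc a b)))

<ℤ⇒+ᴺ : ∀ {k k'} → k <ℤ k' → Σ ℕ λ j → k' ≡ k +ᴺ suc j
<ℤ⇒+ᴺ (-<- {m} {n} n<m) = m ∸ suc n ,
  sym (trans (cong (λ i → -[1+ i ] +ᴺ suc (m ∸ suc n)) (sym gap)) (+ᴺ-neg (suc (m ∸ suc n)) n))
  where
  gap : suc (m ∸ suc n) +ℕ n ≡ m
  gap = trans (sym (ℕ.+-suc (m ∸ suc n) n)) (ℕ.m∸n+n≡m n<m)
<ℤ⇒+ᴺ (-<+ {m} {n}) = m +ℕ n ,
  sym (trans (sym (+ᴺ-assoc -[1+ m ] (suc m) n)) (trans (cong (_+ᴺ n) to-zero) (+ᴺ-pos 0 n)))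
  where
  to-zero : -[1+ m ] +ᴺ suc m ≡ pos 0
  to-zero = cong sucℤ (trans (cong (λ i → -[1+ i ] +ᴺ m) (sym (ℕ.+-identityʳ m))) (+ᴺ-neg m 0))
<ℤ⇒+ᴺ (+<+ {m} {n} m<n) = n ∸ suc m ,
  sym (trans (+ᴺ-pos m (suc (n ∸ suc m))) (cong pos (trans (ℕ.+-suc m (n ∸ suc m)) (ℕ.m+[n∸m]≡n m<n))))

module Orbit (M : PDG) where
  open PDG M
  open OrderedGroup M

  χ0≡0 : χ 0# ≡ 0#
  χ0≡0 = proj₂ (χ-zero 0#) refl

  S-negative : ∀ {x} → InS x → x < 0#
  S-negative (a , a<0 , refl) with χ-mono (inj₁ a<0)
  ... | inj₁ χa<χ0 = subst (χ a <_) χ0≡0 χa<χ0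
  ... | inj₂ χa≡χ0 = ⊥-elim (<-irrefl _ (subst (_< 0#) (proj₁ (χ-zero a) (trans χa≡χ0 χ0≡0)) a<0))

  c<0 : c < 0#
  c<0 = S-negative c-in

  χ-S : ∀ {x} → InS x → InS (χ x)
  χ-S {x} sx = proj₁ (χ-S-into x sx)

  c<χ : ∀ {x} → InS x → c < χ x
  c<χ {x} sx = proj₂ (χ-S-into x sx)

  c≡⊎c< : ∀ {x} → InS x → x ≡ c ⊎ c < x
  c≡⊎c< {x} sx with c-least x sx
  ... | inj₁ c<x = inj₂ c<x
  ... | inj₂ c≡x = inj₁ (sym c≡x)

  -- χ moves points of S strictly upwards (centripetality)
  <χ : ∀ {x} → InS x → x < χ x
  <χ {x} sx = neg-reflects-< (χ-centripetal x (- x) (- χ x) x≢0 (inj₂ (x<0 , refl)) (inj₂ (S-negative (χ-S sx) , refl)))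
    where
    x<0 = S-negative sx
    x≢0 : x ≢ 0#
    x≢0 x≡0 = <-irrefl _ (subst (_< 0#) x≡0 x<0)

  -- χ is strictly increasing on S, being monotone and injective there
  χ-strictMono : ∀ {a b} → InS a → InS b → a < b → χ a < χ b
  χ-strictMono {a} {b} sa sb a<b with χ-mono (inj₁ a<b)
  ... | inj₁ χa<χb = χa<χb
  ... | inj₂ χa≡χb = ⊥-elim (<-irrefl _ (subst (a <_) (sym (χ-S-inj a b sa sb χa≡χb)) a<b))

  χ-reflects-≤ : ∀ {a b} → InS a → InS b → χ a ≤ χ b → a ≤ b
  χ-reflects-≤ {a} {b} sa sb χa≤χb with <⊎≥ b a
  ... | inj₁ b<a = ⊥-elim (<⇒≱ (χ-strictMono sb sa b<a) χa≤χb)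
  ... | inj₂ a≤b = a≤b

  χⁿ : ℕ → Γ → Γ
  χⁿ zero    a = a
  χⁿ (suc n) a = χ (χⁿ n a)

  χⁿ-S : ∀ n {a} → InS a → InS (χⁿ n a)
  χⁿ-S zero    sa = sa
  χⁿ-S (suc n) sa = χ-S (χⁿ-S n sa)

  χⁿ-strictMono : ∀ n {a b} → InS a → InS b → a < b → χⁿ n a < χⁿ n b
  χⁿ-strictMono zero    sa sb a<b = a<b
  χⁿ-strictMono (suc n) sa sb a<b = χ-strictMono (χⁿ-S n sa) (χⁿ-S n sb) (χⁿ-strictMono n sa sb a<b)

  χⁿ-mono : ∀ n {a b} → InS a → InS b → a ≤ b → χⁿ n a ≤ χⁿ n b
  χⁿ-mono n sa sb (inj₁ a<b)  = inj₁ (χⁿ-strictMono n sa sb a<b)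
  χⁿ-mono n sa sb (inj₂ refl) = inj₂ refl

  χⁿ-reflects-< : ∀ n {a b} → InS a → InS b → χⁿ n a < χⁿ n b → a < b
  χⁿ-reflects-< n {a} {b} sa sb χⁿa<χⁿb with <⊎≥ a b
  ... | inj₁ a<b = a<b
  ... | inj₂ b≤a = ⊥-elim (<⇒≱ χⁿa<χⁿb (χⁿ-mono n sb sa b≤a))

  χⁿ-inflationary : ∀ j {t} → InS t → t < χⁿ (suc j) t
  χⁿ-inflationary zero    st = <χ st
  χⁿ-inflationary (suc j) st = <-trans (χⁿ-inflationary j st) (<χ (χⁿ-S (suc j) st))

  χⁿ-onto : ∀ n {y} → InS y → χⁿ n c ≤ y → Σ Γ λ z → InS z × χⁿ n z ≡ y
  χⁿ-onto zero    {y} sy _ = y , sy , refl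
  χⁿ-onto (suc n) {y} sy χⁿ⁺¹c≤y with χ-S-onto y sy (<-≤-trans (c<χ (χⁿ-S n c-in)) χⁿ⁺¹c≤y)
  ... | w , sw , refl with χⁿ-onto n sw (χ-reflects-≤ (χⁿ-S n c-in) sw χⁿ⁺¹c≤y)
  ... | z , sz , χⁿz≡w = z , sz , cong χ χⁿz≡w

  fin-injective : ∀ {a b : Γ} → fin a ≡ fin b → a ≡ b
  fin-injective refl = refl

  fin≢∞ : ∀ {a : Γ} → fin a ≢ ∞
  fin≢∞ ()

  iter-suc : ∀ n (f : Ext Γ → Ext Γ) x → iter M (suc n) f x ≡ iter M n f (f x)
  iter-suc zero    f x = refl
  iter-suc (suc n) f x = cong f (iter-suc n f x)

  χ^-pos : ∀ n x → χ^ M (pos n) (fin x) ≡ fin (χⁿ n x)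
  χ^-pos zero    x = refl
  χ^-pos (suc n) x = cong (χ∞ M) (χ^-pos n x)

  χ⁻ⁿ-∞ : ∀ n → iter M n χ⁻¹ ∞ ≡ ∞
  χ⁻ⁿ-∞ zero    = refl
  χ⁻ⁿ-∞ (suc n) = trans (cong χ⁻¹ (χ⁻ⁿ-∞ n)) χ⁻¹-∞

  χ⁻ⁿ-χⁿ : ∀ n {y} → InS y → iter M n χ⁻¹ (fin (χⁿ n y)) ≡ fin y
  χ⁻ⁿ-χⁿ zero    sy = refl
  χ⁻ⁿ-χⁿ (suc n) {y} sy = trans (iter-suc n χ⁻¹ (fin (χⁿ (suc n) y)))
    (trans (cong (iter M n χ⁻¹) (χ⁻¹-S (χⁿ n y) (χⁿ-S n sy))) (χ⁻ⁿ-χⁿ n sy))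

  χ⁻ⁿ-cases : ∀ n {x} → InS x →
    iter M n χ⁻¹ (fin x) ≡ ∞ ⊎ Σ Γ λ y → InS y × χⁿ n y ≡ x × iter M n χ⁻¹ (fin x) ≡ fin y
  χ⁻ⁿ-cases zero {x} sx = inj₂ (x , sx , refl , refl)
  χ⁻ⁿ-cases (suc n) {x} sx with c≡⊎c< sx
  ... | inj₁ refl = inj₁ (trans (iter-suc n χ⁻¹ (fin c)) (trans (cong (iter M n χ⁻¹) χ⁻¹-c) (χ⁻ⁿ-∞ n)))
  ... | inj₂ c<x with χ-S-onto x sx c<x
  ... | w , sw , refl with χ⁻ⁿ-cases n sw
  ... | inj₁ at-∞ = inj₁ (trans (iter-suc n χ⁻¹ (fin (χ w))) (trans (cong (iter M n χ⁻¹) (χ⁻¹-S w sw)) at-∞))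
  ... | inj₂ (y , sy , χⁿy≡w , at-y) =
    inj₂ (y , sy , cong χ χⁿy≡w , trans (iter-suc n χ⁻¹ (fin (χ w))) (trans (cong (iter M n χ⁻¹) (χ⁻¹-S w sw)) at-y))

  χ⁻¹-fin : ∀ {w y} → InS w → χ⁻¹ (fin w) ≡ fin y → w ≡ χ y
  χ⁻¹-fin {w} {y} sw eq with c≡⊎c< sw
  ... | inj₁ refl = ⊥-elim (fin≢∞ (trans (sym eq) χ⁻¹-c))
  ... | inj₂ c<w with χ-S-onto w sw c<w
  ... | u , su , refl = cong χ (fin-injective (trans (sym (χ⁻¹-S u su)) eq))

  χ^-suc : ∀ k {x y} → InS x → χ^ M k (fin x) ≡ fin y → χ^ M (sucℤ k) (fin x) ≡ fin (χ y)
  χ^-suc (pos n)          sx eq = cong (χ∞ M) eq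
  χ^-suc -[1+ zero ]      sx eq = cong fin (χ⁻¹-fin sx eq)
  χ^-suc -[1+ suc n ] {x} sx eq with χ⁻ⁿ-cases (suc n) sx
  ... | inj₁ at-∞ = ⊥-elim (fin≢∞ (trans (sym eq) (trans (cong χ⁻¹ at-∞) χ⁻¹-∞)))
  ... | inj₂ (w , sw , _ , at-w) = trans at-w (cong fin (χ⁻¹-fin sw (trans (cong χ⁻¹ (sym at-w)) eq)))

  χ^-shift : ∀ k j {x t} → InS x → χ^ M k (fin x) ≡ fin t → χ^ M (k +ᴺ j) (fin x) ≡ fin (χⁿ j t)
  χ^-shift k zero    sx eq = eq
  χ^-shift k (suc j) sx eq = χ^-suc (k +ᴺ j) sx (χ^-shift k j sx eq)

  χ^-strictMono : ∀ k {x y t u} → InS x → InS y →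
    χ^ M k (fin x) ≡ fin t → χ^ M k (fin y) ≡ fin u → x < y → t < u
  χ^-strictMono (pos n) {x} {y} sx sy ex ey x<y =
    subst₂ _<_ (fin-injective (trans (sym (χ^-pos n x)) ex)) (fin-injective (trans (sym (χ^-pos n y)) ey))
      (χⁿ-strictMono n sx sy x<y)
  χ^-strictMono -[1+ m ] sx sy ex ey x<y with χ⁻ⁿ-cases (suc m) sx | χ⁻ⁿ-cases (suc m) sy
  ... | inj₁ at-∞ | _ = ⊥-elim (fin≢∞ (trans (sym ex) at-∞))
  ... | _ | inj₁ at-∞ = ⊥-elim (fin≢∞ (trans (sym ey) at-∞))
  ... | inj₂ (x' , sx' , refl , at-x') | inj₂ (y' , sy' , refl , at-y') =
    subst₂ _<_ (fin-injective (trans (sym at-x') ex)) (fin-injective (trans (sym at-y') ey))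
      (χⁿ-reflects-< (suc m) sx' sy' x<y)

  record Domain (k : ℤ) : Set where
    field
      start     : Γ
      start-in  : InS start
      undefined : ∀ x → InS x → x < start → χ^ M k (fin x) ≡ ∞
      defined   : ∀ x → InS x → start ≤ x → Σ Γ λ t → InS t × χ^ M k (fin x) ≡ fin t
      attained-or-below : ∀ g → InS g →
        (Σ Γ λ z → InS z × start ≤ z × χ^ M k (fin z) ≡ fin g)
        ⊎ (∀ {x t} → InS x → start ≤ x → χ^ M k (fin x) ≡ fin t → g < t)

  -- for k ≥ 0 the domain starts at c; for k = -(m+1) at χ^{m+1}(c), and
  -- there every g ∈ S is attained, at χ^{m+1}(g)
  domain : ∀ k → Domain k
  domain (pos n) = record
    { start = c
    ; start-in = c-in
    ; undefined = λ x sx x<c → ⊥-elim (<⇒≱ x<c (c-least x sx))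
    ; defined = λ x sx _ → χⁿ n x , χⁿ-S n sx , χ^-pos n x
    ; attained-or-below = attained-or-below }
    where
    attained-or-below : ∀ g → InS g →
      (Σ Γ λ z → InS z × c ≤ z × χ^ M (pos n) (fin z) ≡ fin g)
      ⊎ (∀ {x t} → InS x → c ≤ x → χ^ M (pos n) (fin x) ≡ fin t → g < t)
    attained-or-below g sg with <⊎≥ g (χⁿ n c)
    ... | inj₁ g<χⁿc = inj₂ λ {x} sx _ eq →
      subst (g <_) (fin-injective (trans (sym (χ^-pos n x)) eq)) (<-≤-trans g<χⁿc (χⁿ-mono n c-in sx (c-least x sx)))
    ... | inj₂ χⁿc≤g with χⁿ-onto n sg χⁿc≤g
    ... | z , sz , χⁿz≡g = inj₁ (z , sz , c-least z sz , trans (χ^-pos n z) (cong fin χⁿz≡g))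
  domain -[1+ m ] = record
    { start = χⁿ (suc m) c
    ; start-in = χⁿ-S (suc m) c-in
    ; undefined = undefined
    ; defined = defined
    ; attained-or-below = λ g sg → inj₁ (χⁿ (suc m) g , χⁿ-S (suc m) sg ,
        χⁿ-mono (suc m) c-in sg (c-least g sg) , χ⁻ⁿ-χⁿ (suc m) sg) }
    where
    undefined : ∀ x → InS x → x < χⁿ (suc m) c → χ^ M -[1+ m ] (fin x) ≡ ∞
    undefined x sx x<start with χ⁻ⁿ-cases (suc m) sx
    ... | inj₁ at-∞ = at-∞
    ... | inj₂ (y , sy , refl , _) = ⊥-elim (<⇒≱ x<start (χⁿ-mono (suc m) c-in sy (c-least y sy)))
    defined : ∀ x → InS x → χⁿ (suc m) c ≤ x → Σ Γ λ t → InS t × χ^ M -[1+ m ] (fin x) ≡ fin t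
    defined x sx start≤x with χⁿ-onto (suc m) sx start≤x
    ... | y , sy , refl = y , sy , χ⁻ⁿ-χⁿ (suc m) sy

module Expansion (M : PDG) where
  open PDG M
  open OrderedGroup M
  open Archimedean M
  open Orbit M

  -- the value of the term q·u, so that qmul M q (fin u) = fin (scale q u)
  scale : ℚ → Γ → Γ
  scale q u = zmul M (↥ q) (δ (↧ₙ q ∸ 1) u)

  scale-≪ : ∀ q {u N} → N < 0# → u ≪ N → scale q u ≪ N
  scale-≪ q {u} N<0 u≪N = ≪-zmul (↥ q) (≪-divide d (δ-spec d u) N<0 u≪N)
    where d = ↧ₙ q ∸ 1

  tail-negligible : ∀ ts k q {x t} → InS x → InS t → χ^ M k (fin x) ≡ fin t →
    StrictlyIncr M ((q , k) ∷ ts) → Σ Γ λ r → evalTerms M ts x ≡ fin r × r ≪ t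
  tail-negligible [] k q sx st eq incr = 0# , refl , ≪-zero (S-negative st)
  tail-negligible ((q' , k') ∷ ts) k q {x} {t} sx st eq (k<k' , incr) with <ℤ⇒+ᴺ k<k'
  ... | j , refl with tail-negligible ts (k +ᴺ suc j) q' sx (χⁿ-S (suc j) st) (χ^-shift k (suc j) sx eq) incr
  ... | r , value-r , r≪t' =
    scale q' t' + r ,
    cong₂ (_+∞_ M) (cong (qmul M q') (χ^-shift k (suc j) sx eq)) value-r ,
    ≪-+ (scale-≪ q' (S-negative st) t'≪t) (≪-trans r≪t' t'≪t)
    where
    t' = χⁿ (suc j) t
    t'≪t : t' ≪ t
    t'≪t = χ<χ⇒≪ (S-negative st) (S-negative (χⁿ-S (suc j) st))
             (χ-strictMono st (χⁿ-S (suc j) st) (χⁿ-inflationary j st))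

  signed : ℤ → Γ → Γ
  signed (pos _)  y = y
  signed -[1+ _ ] y = - y

  leading-dominates : ∀ p d {t u} → p ≢ pos 0 → t < 0# → u ≪ t →
    χ (zmul M p (δ d t) + u) ≡ signed p (χ t)
  leading-dominates (pos zero)    d p≢0 _   _   = ⊥-elim (p≢0 refl)
  leading-dominates (pos (suc k)) d _   t<0 u≪t = χ-perturb t<0 (≍-fraction d k t<0 (δ-spec d _)) u≪t
  leading-dominates -[1+ k ]      d _   t<0 u≪t = χ-perturb-neg t<0 (≍-fraction d k t<0 (δ-spec d _)) u≪t

module Pieces (M : PDG) (G : PDG.Γ M → Ext (PDG.Γ M)) where
  open PDG M
  open OrderedGroup M

  Endpoint : Γ → Set
  Endpoint a = InS a ⊎ a ≡ 0#

  GoodPiece : Γ → Γ → Set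
  GoodPiece l r = Σ (Γ → Ext Γ) λ H → IsChiFunction M H ×
    (∀ x → InS x → l ≤ x → x < r → χ∞ M (G x) ≡ H x)

  open Partitions _<_ Endpoint GoodPiece public

  constant-piece : ∀ {l r} v → (∀ x → InS x → l ≤ x → x < r → χ∞ M (G x) ≡ v) → GoodPiece l r
  constant-piece v agree = (λ _ → v) , inj₁ (v , λ _ _ → refl) , agree

  -- S ∩ [p, χ p) = {p} by axiom (iii), so this piece is trivially good
  point-piece : ∀ {p} → InS p → GoodPiece p (χ p)
  point-piece {p} sp = constant-piece (χ∞ M (G p)) agree
    where
    agree : ∀ x → InS x → p ≤ x → x < χ p → χ∞ M (G x) ≡ χ∞ M (G p)
    agree x sx (inj₂ refl) _    = refl
    agree x sx (inj₁ p<x) x<χp = ⊥-elim (<⇒≱ x<χp (proj₂ (χ-S-between p x sp sx p<x)))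

signℚ : ℤ → ℚ
signℚ (pos _)  = 1ℚ
signℚ -[1+ _ ] = -ℚ 1ℚ

module LeadingTerm (M : PDG) (G : PDG.Γ M → Ext (PDG.Γ M))
    (q : ℚ) (k : ℤ) (rest : List (ℚ × ℤ)) (α : PDG.Γ M)
    (incr : StrictlyIncr M ((q , k) ∷ rest)) (q≢0 : q ≢ 0ℚ)
    (G≡ : ∀ x → PDG.InS M x → G x ≡ _+∞_ M (evalTerms M ((q , k) ∷ rest) x) (fin (PDG.-_ M α)))
    where
  open PDG M
  open OrderedGroup M
  open Archimedean M
  open Orbit M
  open Expansion M
  open Pieces M G
  open Domain (domain k)

  p : ℤ
  p = ↥ q

  p≢0 : p ≢ pos 0
  p≢0 p≡0 = q≢0 (↥p≡0⇒p≡0 q p≡0)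

  χG-expansion : ∀ {x t} → InS x → InS t → χ^ M k (fin x) ≡ fin t →
    Σ Γ λ r → r ≪ t × χ∞ M (G x) ≡ fin (χ ((scale q t + r) + - α))
  χG-expansion {x} sx st eq with tail-negligible rest k q sx st eq incr
  ... | r , value-r , r≪t = r , r≪t ,
    cong (χ∞ M) (trans (G≡ x sx) (cong (λ v → _+∞_ M v (fin (- α))) (cong₂ (_+∞_ M) (cong (qmul M q) eq) value-r)))

  leadingχ : Γ → Ext Γ
  leadingχ x = _+∞_ M (evalTerms M ((signℚ p , sucℤ k) ∷ []) x) (fin (- 0#))

  leadingχ-isχ : IsChiFunction M leadingχ
  leadingχ-isχ = inj₂ ((signℚ p , sucℤ k) ∷ [] , 0# , (λ ()) , tt , (signℚ≢0 p , tt) , λ _ _ → refl)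
    where
    signℚ≢0 : ∀ p → signℚ p ≢ 0ℚ
    signℚ≢0 (pos _)  ()
    signℚ≢0 -[1+ _ ] ()

  leadingχ-value : ∀ {x t} → InS x → χ^ M k (fin x) ≡ fin t → leadingχ x ≡ fin (signed p (χ t))
  leadingχ-value {x} {t} sx eq rewrite χ^-suc k sx eq =
    cong fin (trans (cong₂ _+_ (identityʳ _) ε⁻¹≈ε) (trans (identityʳ _) (scale-sign p (χ t))))
    where
    scale-sign : ∀ p y → scale (signℚ p) y ≡ signed p y
    scale-sign (pos _)  y = δ-spec 0 y
    scale-sign -[1+ _ ] y = cong -_ (δ-spec 0 y)

  leading-regime : ∀ {x t} → InS x → InS t → χ^ M k (fin x) ≡ fin t → α ≪ t → χ∞ M (G x) ≡ leadingχ x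
  leading-regime {x} {t} sx st eq α≪t with χG-expansion sx st eq
  ... | r , r≪t , χGx = trans χGx (trans (cong fin χ-value) (sym (leadingχ-value sx eq)))
    where
    χ-value : χ ((scale q t + r) + - α) ≡ signed p (χ t)
    χ-value = trans (cong χ (+-assoc (scale q t) r (- α)))
                (leading-dominates p (↧ₙ q ∸ 1) p≢0 (S-negative st) (≪-+ r≪t (≪-neg α≪t)))

  constant-regime : ∀ {x t A} → A < 0# → (α ≡ A ⊎ α ≡ - A) → InS x → InS t →
    χ^ M k (fin x) ≡ fin t → t ≪ A → χ∞ M (G x) ≡ fin (χ (- α))
  constant-regime {x} {t} {A} A<0 α≡±A sx st eq t≪A with χG-expansion sx st eq
  ... | r , r≪t , χGx =
    trans χGx (cong fin (χ-absorbs A<0 (negate α≡±A) (≪-+ (scale-≪ q A<0 t≪A) (≪-trans r≪t t≪A))))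
    where
    negate : α ≡ A ⊎ α ≡ - A → - α ≡ A ⊎ - α ≡ - A
    negate (inj₁ refl) = inj₂ refl
    negate (inj₂ refl) = inj₁ (⁻¹-involutive A)

  leading-piece : ∀ {l r} → start ≤ l →
    (∀ {x t} → InS x → InS t → l ≤ x → x < r → χ^ M k (fin x) ≡ fin t → α ≪ t) → GoodPiece l r
  leading-piece {l} {r} start≤l α-negligible = leadingχ , leadingχ-isχ , agree
    where
    agree : ∀ x → InS x → l ≤ x → x < r → χ∞ M (G x) ≡ leadingχ x
    agree x sx l≤x x<r with defined x sx (≤-trans start≤l l≤x)
    ... | t , st , eq = leading-regime sx st eq (α-negligible sx st l≤x x<r eq)

  constant-piece-for : ∀ {l r A} → A < 0# → (α ≡ A ⊎ α ≡ - A) → start ≤ l →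
    (∀ {x t} → InS x → InS t → l ≤ x → χ^ M k (fin x) ≡ fin t → χ A < χ t) → GoodPiece l r
  constant-piece-for {l} {r} A<0 α≡±A start≤l χA<χt = constant-piece (fin (χ (- α))) agree
    where
    agree : ∀ x → InS x → l ≤ x → x < r → χ∞ M (G x) ≡ fin (χ (- α))
    agree x sx l≤x _ with defined x sx (≤-trans start≤l l≤x)
    ... | t , st , eq = constant-regime A<0 α≡±A sx st eq (χ<χ⇒≪ A<0 (S-negative st) (χA<χt sx st l≤x eq))

  partition-α≡0 : α ≡ 0# → Partition start 0#
  partition-α≡0 α≡0 = single (S-negative start-in) (inj₂ refl)
    (leading-piece (inj₂ refl) λ _ st _ _ _ → subst (_≪ _) (sym α≡0) (≪-zero (S-negative st)))

  ≪-± : ∀ {A t} → (α ≡ A ⊎ α ≡ - A) → A ≪ t → α ≪ t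
  ≪-± (inj₁ refl) A≪t = A≪t
  ≪-± (inj₂ refl) A≪t = ≪-neg A≪t

  all-constant : ∀ {A} → A < 0# → (α ≡ A ⊎ α ≡ - A) →
    (∀ {x t} → InS x → InS t → start ≤ x → χ^ M k (fin x) ≡ fin t → χ A < χ t) → Partition start 0#
  all-constant A<0 α≡±A above =
    single (S-negative start-in) (inj₂ refl) (constant-piece-for A<0 α≡±A (inj₂ refl) above)

  split-at : ∀ {A g z} → A < 0# → (α ≡ A ⊎ α ≡ - A) → InS g → χ g ≡ χ A →
    InS z → start ≤ z → χ^ M k (fin z) ≡ fin g → Partition start 0#
  split-at {A} {g} {z} A<0 α≡±A sg χg≡χA sz start≤z at-z =
    before start≤z ++ piece (<χ sz) (inj₁ (χ-S sz)) (point-piece sz)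
                (single (S-negative (χ-S sz)) (inj₂ refl) after)
    where
    below-z : ∀ {x t} → InS x → InS t → x < z → χ^ M k (fin x) ≡ fin t → α ≪ t
    below-z sx st x<z eq = ≪-± α≡±A (χ<χ⇒≪ (S-negative st) A<0
      (subst (χ _ <_) χg≡χA (χ-strictMono st sg (χ^-strictMono k sx sz eq at-z x<z))))
    before : start ≤ z → Partition start z
    before (inj₁ start<z) = single start<z (inj₁ sz) (leading-piece (inj₂ refl) λ sx st _ x<z eq → below-z sx st x<z eq)
    before (inj₂ start≡z) = subst (Partition start) start≡z stop
    after : GoodPiece (χ z) 0#
    after = constant-piece-for A<0 α≡±A (≤-trans start≤z (inj₁ (<χ sz))) λ sx st χz≤x eq →
      subst (_< χ _) χg≡χA (χ-strictMono sg st (χ^-strictMono k sz sx at-z eq (<-≤-trans (<χ sz) χz≤x)))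

  -- α = ±A with A < 0: compare χ(χ^k x) with χ(A), a point of S
  partition-α≢0 : ∀ A → A < 0# → (α ≡ A ⊎ α ≡ - A) → Partition start 0#
  partition-α≢0 A A<0 α≡±A with c≡⊎c< {χ A} (A , A<0 , refl)
  ... | inj₁ χA≡c = all-constant A<0 α≡±A λ _ st _ _ → subst (_< _) (sym χA≡c) (c<χ st)
  ... | inj₂ c<χA with χ-S-onto (χ A) (A , A<0 , refl) c<χA
  ... | g , sg , χg≡χA with attained-or-below g sg
  ... | inj₁ (z , sz , start≤z , at-z) = split-at A<0 α≡±A sg χg≡χA sz start≤z at-z
  ... | inj₂ g<values = all-constant A<0 α≡±A λ sx st start≤x eq →
    subst (_< χ _) χg≡χA (χ-strictMono sg st (g<values sx start≤x eq))

  partition : Partition start 0#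
  partition with <-tri α 0#
  ... | inj₁ α<0        = partition-α≢0 α α<0 (inj₁ refl)
  ... | inj₂ (inj₁ α≡0) = partition-α≡0 α≡0
  ... | inj₂ (inj₂ 0<α) = partition-α≢0 (- α) (neg-of-positive 0<α) (inj₂ (sym (⁻¹-involutive α)))

module Decomposition (M : PDG) (G : PDG.Γ M → Ext (PDG.Γ M)) where
  open PDG M
  open Orbit M
  open Pieces M G

  partition : IsChiFunction M G → Partition c 0#
  partition (inj₁ (v , G≡v)) =
    single c<0 (inj₂ refl) (constant-piece (χ∞ M v) λ x sx _ _ → cong (χ∞ M) (G≡v x sx))
  partition (inj₂ ([] , _ , ts≢[] , _)) = ⊥-elim (ts≢[] refl)
  partition (inj₂ ((q , k) ∷ rest , α , _ , incr , (q≢0 , _) , G≡)) =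
    undefined-part ++ LeadingTerm.partition M G q k rest α incr q≢0 G≡
    where
    open Domain (domain k)
    -- below the domain of χ^k the leading term, hence G, is ∞
    G≡∞ : ∀ x → InS x → c ≤ x → x < start → χ∞ M (G x) ≡ ∞
    G≡∞ x sx _ x<start = cong (χ∞ M) (trans (G≡ x sx)
      (cong (λ w → _+∞_ M (_+∞_ M (qmul M q w) (evalTerms M rest x)) (fin (- α))) (undefined x sx x<start)))
    undefined-part : Partition c start
    undefined-part with c≡⊎c< start-in
    ... | inj₁ start≡c = subst (Partition c) (sym start≡c) stop
    ... | inj₂ c<start = single c<start (inj₁ start-in) (constant-piece ∞ G≡∞)

mainTheorem8 : (M : PDG) → let open PDG M in
    (G : Γ → Ext Γ) → IsChiFunction M G →
    Σ ℕ λ n → Σ (ℕ → Γ) λ a →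
      a 0 ≡ c × a n ≡ 0# ×
      (∀ i → i ≤ℕ n → InS (a i) ⊎ a i ≡ 0#) ×
      (∀ i → i <ℕ n → a i < a (suc i)) ×
      (∀ i → i <ℕ n → Σ (Γ → Ext Γ) λ H → IsChiFunction M H ×
         (∀ x → InS x → a i ≤ x → x < a (suc i) → χ∞ M (G x) ≡ H x))
mainTheorem8 M G isχ = Pieces.toSequence M G (inj₁ (PDG.c-in M)) (Decomposition.partition M G isχ)
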